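{- If $n\geq 3$, $p\geq 2$ and $m\geq 1$ are integers, then $\chi_\rho(FSSD_m(K_n\star P_p)) = n+3$.
   Context: All graphs are finite and simple. For a positive integer $i$, an $i$-packing is a set of vertices in which any two distinct vertices are at distance greater than $i$. The packing chromatic number $\chi_\rho(H)$ of a graph $H$ is the smallest integer $k$ such that $V(H)$ can be partitioned into sets $V_1,\dots,V_k$ with each $V_i$ an $i$-packing. The neighborhood corona $G\star H$ of a graph $G$ with vertices $w_1,\dots,w_{n_1}$ and a graph $H$ is obtained from one copy of $G$ and $n_1$ disjoint copies $H_1,\dots,H_{n_1}$ of $H$ by joining every vertex of $H_i$ to every neighbor of $w_i$ in $G$. Here $K_n$ is the complete graph on $n$ vertices and $P_p$ is the path on $p$ vertices. For a positive integer $m$, the finite super subdivision graph $FSSD_m(G)$ is obtained from a graph $G$ by replacing each edge $xy$ of $G$ by a complete bipartite graph $K_{2,m}$ whose part of size $2$ is $\{x,y\}$; that is, the edge $xy$ is deleted and $m$ new vertices are added, each adjacent exactly to $x$ and $y$. -}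

module Defs where

open import Data.Nat using (ℕ; zero; suc; _≤_; _<_)
open import Data.Fin using (Fin; toℕ; fromℕ<)
open import Data.Bool using (Bool; true; false)
open import Data.Product using (Σ; _×_; _,_; ∃)
open import Data.Sum using (_⊎_; inj₁; inj₂)
open import Relation.Binary.PropositionalEquality using (_≡_; _≢_)
open import Relation.Nullary using (¬_)

record Graph : Set₁ where
  field
    V    : Set
    E    : Set
    ends : E → V × V
open Graph public

Adj : (G : Graph) → V G → V G → Set
Adj G u v = Σ (E G) λ e → (ends G e ≡ (u , v)) ⊎ (ends G e ≡ (v , u))

data Walk (G : Graph) : V G → V G → ℕ → Set where
  here : ∀ {u} → Walk G u u 0
  step : ∀ {u v w ℓ} → Adj G u v → Walk G v w ℓ → Walk G u w (suc ℓ)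

-- dist(u,v) > i  (also true when u,v are in different components)
DistGreater : (G : Graph) → V G → V G → ℕ → Set
DistGreater G u v i = ∀ ℓ → ℓ ≤ i → ¬ Walk G u v ℓ

IsPacking : (G : Graph) → (V G → Set) → ℕ → Set
IsPacking G S i = ∀ u v → S u → S v → u ≢ v → DistGreater G u v i

-- A packing k-colouring: colour j : Fin k stands for class V_{j+1},
-- which must be a (j+1)-packing.
IsPackingColouring : (G : Graph) (k : ℕ) → (V G → Fin k) → Set
IsPackingColouring G k c =
  ∀ (j : Fin k) → IsPacking G (λ v → c v ≡ j) (suc (toℕ j))

HasPackingColouring : Graph → ℕ → Set
HasPackingColouring G k = Σ (V G → Fin k) (IsPackingColouring G k)

PackingChromaticNumber≡ : Graph → ℕ → Set
PackingChromaticNumber≡ G k =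
  HasPackingColouring G k × (∀ k′ → HasPackingColouring G k′ → k ≤ k′)

K : ℕ → Graph
K n = record
  { V = Fin n
  ; E = Σ (Fin n × Fin n) (λ { (i , j) → toℕ i < toℕ j })
  ; ends = λ { (ij , _) → ij } }

P : ℕ → Graph
P p = record
  { V = Fin p
  ; E = Σ (Fin p) (λ i → suc (toℕ i) < p)
  ; ends = λ { (i , h) → (i , fromℕ< h) } }

-- Vertices: inj₁ w (vertex of G) and inj₂ (w , h) (vertex h of the copy H_w).
-- Edges: edges of G; edges of each copy H_w; and for every edge e = (x,y)
-- of G and h ∈ V H, an edge joining (x,h) to y (flag false) and one
-- joining (y,h) to x (flag true) — i.e. each vertex of H_w is joined to
-- every neighbour of w in G.
_⋆_ : Graph → Graph → Graph
G ⋆ H = record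
  { V = V G ⊎ (V G × V H)
  ; E = E G ⊎ ((V G × E H) ⊎ (E G × V H × Bool))
  ; ends = f }
  where
  f : E G ⊎ ((V G × E H) ⊎ (E G × V H × Bool)) → (V G ⊎ (V G × V H)) × (V G ⊎ (V G × V H))
  f (inj₁ e) with ends G e
  ... | (x , y) = (inj₁ x , inj₁ y)
  f (inj₂ (inj₁ (w , e))) with ends H e
  ... | (a , b) = (inj₂ (w , a) , inj₂ (w , b))
  f (inj₂ (inj₂ (e , h , false))) with ends G e
  ... | (x , y) = (inj₂ (x , h) , inj₁ y)
  f (inj₂ (inj₂ (e , h , true))) with ends G e
  ... | (x , y) = (inj₂ (y , h) , inj₁ x)

-- Finite super subdivision FSSD_m(G): each edge e = xy is replaced by
-- m new vertices (e , k), k : Fin m, each adjacent exactly to x and y.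
FSSD : ℕ → Graph → Graph
FSSD m G = record
  { V = V G ⊎ (E G × Fin m)
  ; E = E G × Fin m × Bool
  ; ends = f }
  where
  f : E G × Fin m × Bool → (V G ⊎ (E G × Fin m)) × (V G ⊎ (E G × Fin m))
  f (e , k , false) with ends G e
  ... | (x , y) = (inj₁ x , inj₂ (e , k))
  f (e , k , true) with ends G e
  ... | (x , y) = (inj₁ y , inj₂ (e , k))

module Submission where

-- Colour indices start at 0: index j is the paper's colour j+1, whose class
-- must be a (j+1)-packing.  In FSSD_m(G) the original vertices form one side
-- of a bipartition; two original vertices are at distance 2 iff they are
-- adjacent in G, and never at odd distance.
--
-- Upper bound: give all subdivision vertices index 0 and lift a colouring of
-- G in which repeated indices are 1 or 2 and only occur on non-adjacent
-- vertices (lemma subdivision-colouring).  For K_n ⋆ P_p the copy vertices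
-- get 1 or 2 by parity along the path and the n vertices of K_n get 3,…,n+2.
--
-- Lower bound: the neighbours of a vertex of index 0 have pairwise different
-- nonzero indices.  If some vertex of K_n has index 0, it has n+2 neighbours
-- (lemma zero-vertex-count).  Otherwise the n vertices of K_n carry distinct
-- nonzero indices, one of them, T_i, at least 3, and it suffices to find two
-- "fresh" vertices: nonzero index different from all of these and from each
-- other.  They are found among the copies of T_i's path or, when such a copy
-- has index 0, among the subdivision vertices around it (module BigTop).

open import Defs
open import Data.Nat using (ℕ; zero; suc; _≤_; _+_; z≤n; s≤s; _≟_; _≤?_)
open import Data.Nat.Properties using (≤-trans; +-comm; <-cmp)
open import Data.Fin using (Fin; toℕ; zero; suc; punchIn)
open import Data.Fin.Properties
  using (toℕ-injective; toℕ-fromℕ<; suc-injective; punchInᵢ≢i; punchIn-injective; any?; injective⇒≤)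
  renaming (_≟_ to _≟ᶠ_)
open import Data.Vec.Functional using (_∷_)
open import Data.Bool using (Bool; true; false; not)
open import Data.Bool.Properties using (not-¬)
open import Data.Product using (Σ; _×_; _,_; proj₁; proj₂)
open import Data.Sum using (_⊎_; inj₁; inj₂; swap)
open import Data.Sum.Properties using (inj₁-injective; inj₂-injective)
open import Data.Empty using (⊥; ⊥-elim)
open import Function using (_∘_)
open import Function.Definitions using (Injective)
open import Relation.Binary.PropositionalEquality
open import Relation.Binary using (tri<; tri≈; tri>)
open import Relation.Nullary using (¬_; yes; no)

2≤suc : ∀ {x} → x ≢ 0 → 2 ≤ suc x
2≤suc {zero}  x≢0 = ⊥-elim (x≢0 refl)
2≤suc {suc x} _   = s≤s (s≤s z≤n)

3≤suc : ∀ {x} → x ≢ 0 → x ≢ 1 → 3 ≤ suc x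
3≤suc {zero}        x≢0 _   = ⊥-elim (x≢0 refl)
3≤suc {suc zero}    _   x≢1 = ⊥-elim (x≢1 refl)
3≤suc {suc (suc x)} _   _   = s≤s (s≤s (s≤s z≤n))

OneOrTwo : ℕ → Set
OneOrTwo x = x ≡ 1 ⊎ x ≡ 2

one-or-two : ∀ {x} → x ≢ 0 → ¬ 3 ≤ x → OneOrTwo x
one-or-two {zero}              x≢0 _   = ⊥-elim (x≢0 refl)
one-or-two {suc zero}          _   _   = inj₁ refl
one-or-two {suc (suc zero)}    _   _   = inj₂ refl
one-or-two {suc (suc (suc x))} _   x<3 = ⊥-elim (x<3 (s≤s (s≤s (s≤s z≤n))))

no-three-in-one-or-two : ∀ {x y z} → OneOrTwo x → OneOrTwo y → OneOrTwo z →
                         x ≢ y → x ≢ z → y ≢ z → ⊥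
no-three-in-one-or-two (inj₁ refl) (inj₁ refl) _           x≢y _   _   = x≢y refl
no-three-in-one-or-two (inj₂ refl) (inj₂ refl) _           x≢y _   _   = x≢y refl
no-three-in-one-or-two (inj₁ refl) (inj₂ refl) (inj₁ refl) _   x≢z _   = x≢z refl
no-three-in-one-or-two (inj₁ refl) (inj₂ refl) (inj₂ refl) _   _   y≢z = y≢z refl
no-three-in-one-or-two (inj₂ refl) (inj₁ refl) (inj₁ refl) _   _   y≢z = y≢z refl
no-three-in-one-or-two (inj₂ refl) (inj₁ refl) (inj₂ refl) _   x≢z _   = x≢z refl

∷-injective : ∀ {A : Set} {N} {x : A} {f : Fin N → A} →
              Injective _≡_ _≡_ f → (∀ a → x ≢ f a) → Injective _≡_ _≡_ (x ∷ f)
∷-injective inj fresh {zero}  {zero}  _ = refl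
∷-injective inj fresh {zero}  {suc b} e = ⊥-elim (fresh b e)
∷-injective inj fresh {suc a} {zero}  e = ⊥-elim (fresh a (sym e))
∷-injective inj fresh {suc a} {suc b} e = cong suc (inj e)

nonzero-count : ∀ {N k} (g : Fin (suc N) → Fin k) → Injective _≡_ _≡_ g →
                (∀ a → toℕ (g a) ≢ 0) → 2 + N ≤ k
nonzero-count {k = zero}  g _   _  with g zero
... | ()
nonzero-count {k = suc k} g inj nz =
  injective⇒≤ {f = zero ∷ g} (∷-injective inj (λ a e → nz a (cong toℕ (sym e))))

_++ʷ_ : ∀ {G u v w a b} → Walk G u v a → Walk G v w b → Walk G u w (a + b)
here     ++ʷ q = q
step x p ++ʷ q = step x (p ++ʷ q)

adj-sym : ∀ {G u v} → Adj G u v → Adj G v u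
adj-sym a = proj₁ a , swap (proj₂ a)

same-edge : ∀ {G u v w} (a : Adj G u w) (b : Adj G v w) → proj₁ a ≡ proj₁ b → u ≡ v
same-edge (e , inj₁ p) (.e , inj₁ q) refl with trans (sym p) q
... | refl = refl
same-edge (e , inj₁ p) (.e , inj₂ q) refl with trans (sym p) q
... | refl = refl
same-edge (e , inj₂ p) (.e , inj₁ q) refl with trans (sym p) q
... | refl = refl
same-edge (e , inj₂ p) (.e , inj₂ q) refl with trans (sym p) q
... | refl = refl

module PackingColouring (G : Graph) {k : ℕ} (c : V G → Fin k)
                        (packing : IsPackingColouring G k c) where

  colour : V G → ℕ
  colour u = toℕ (c u)

  differ : ∀ {u v ℓ} → u ≢ v → Walk G u v ℓ → ℓ ≤ suc (colour u) → c u ≢ c v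
  differ {u} {v} u≢v w ℓ≤ cu≡cv = packing (c u) u v refl (sym cu≡cv) u≢v _ ℓ≤ w

  around-zero-nonzero : ∀ {u z} → colour z ≡ 0 → Adj G u z → u ≢ z → colour u ≢ 0
  around-zero-nonzero z0 a u≢z u0 =
    differ u≢z (step a here) (s≤s z≤n) (toℕ-injective (trans u0 (sym z0)))

  around-zero-distinct : ∀ {u v z} → colour z ≡ 0 → Adj G u z → Adj G v z →
                         u ≢ z → u ≢ v → c u ≢ c v
  around-zero-distinct z0 a b u≢z u≢v =
    differ u≢v (step a (step (adj-sym b) here)) (2≤suc (around-zero-nonzero z0 a u≢z))

module Corona {G H : Graph} where

  base-adj : ∀ {x y} → Adj G x y → Adj (G ⋆ H) (inj₁ x) (inj₁ y)
  base-adj (e , inj₁ eq) = inj₁ e , inj₁ (cong (λ q → inj₁ (proj₁ q) , inj₁ (proj₂ q)) eq)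
  base-adj (e , inj₂ eq) = inj₁ e , inj₂ (cong (λ q → inj₁ (proj₁ q) , inj₁ (proj₂ q)) eq)

  copy-adj : ∀ {w a b} → Adj H a b → Adj (G ⋆ H) (inj₂ (w , a)) (inj₂ (w , b))
  copy-adj {w} (e , inj₁ eq) =
    inj₂ (inj₁ (w , e)) , inj₁ (cong (λ q → inj₂ (w , proj₁ q) , inj₂ (w , proj₂ q)) eq)
  copy-adj {w} (e , inj₂ eq) =
    inj₂ (inj₁ (w , e)) , inj₂ (cong (λ q → inj₂ (w , proj₁ q) , inj₂ (w , proj₂ q)) eq)

  copy-base-adj : ∀ {w y h} → Adj G w y → Adj (G ⋆ H) (inj₂ (w , h)) (inj₁ y)
  copy-base-adj {h = h} (e , inj₁ eq) =
    inj₂ (inj₂ (e , h , false)) , inj₁ (cong (λ q → inj₂ (proj₁ q , h) , inj₁ (proj₂ q)) eq)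
  copy-base-adj {h = h} (e , inj₂ eq) =
    inj₂ (inj₂ (e , h , true)) , inj₁ (cong (λ q → inj₂ (proj₂ q , h) , inj₁ (proj₁ q)) eq)

  copies-adj⁻¹ : ∀ {w w' a b} → Adj (G ⋆ H) (inj₂ (w , a)) (inj₂ (w' , b)) → w ≡ w' × Adj H a b
  copies-adj⁻¹ (inj₂ (inj₁ (u , e)) , inj₁ refl)         = refl , e , inj₁ refl
  copies-adj⁻¹ (inj₂ (inj₁ (u , e)) , inj₂ refl)         = refl , e , inj₂ refl
  copies-adj⁻¹ (inj₁ e , inj₁ ())
  copies-adj⁻¹ (inj₁ e , inj₂ ())
  copies-adj⁻¹ (inj₂ (inj₂ (e , h , false)) , inj₁ ())
  copies-adj⁻¹ (inj₂ (inj₂ (e , h , true))  , inj₁ ())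
  copies-adj⁻¹ (inj₂ (inj₂ (e , h , false)) , inj₂ ())
  copies-adj⁻¹ (inj₂ (inj₂ (e , h , true))  , inj₂ ())

open Corona

K-adj : ∀ {n} {i j : Fin n} → i ≢ j → Adj (K n) i j
K-adj {i = i} {j} i≢j with <-cmp (toℕ i) (toℕ j)
... | tri< lt _ _ = ((i , j) , lt) , inj₁ refl
... | tri≈ _ eq _ = ⊥-elim (i≢j (toℕ-injective eq))
... | tri> _ _ gt = ((j , i) , gt) , inj₂ refl

P-adj₀₁ : ∀ {p} → Adj (P (2 + p)) zero (suc zero)
P-adj₀₁ = (zero , s≤s (s≤s z≤n)) , inj₁ refl

parity : ℕ → Bool
parity zero    = true
parity (suc x) = not (parity x)

P-adj-parity : ∀ {p} {a b : Fin p} → Adj (P p) a b → parity (toℕ a) ≢ parity (toℕ b)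
P-adj-parity ((i , lt) , inj₁ refl) e =
  not-¬ refl (trans e (cong parity (toℕ-fromℕ< lt)))
P-adj-parity ((i , lt) , inj₂ refl) e =
  not-¬ refl (trans (sym e) (cong parity (toℕ-fromℕ< lt)))

-- Structure of FSSD_m(G): edges join an original vertex to a subdivision
-- vertex, so original vertices at distance at most 3 are equal or adjacent in G.
module Subdivision (m : ℕ) (G : Graph) where

  no-adj-originals : ∀ {x y} → ¬ Adj (FSSD m G) (inj₁ x) (inj₁ y)
  no-adj-originals ((e , k , false) , inj₁ ())
  no-adj-originals ((e , k , true)  , inj₁ ())
  no-adj-originals ((e , k , false) , inj₂ ())
  no-adj-originals ((e , k , true)  , inj₂ ())

  no-adj-subdivisions : ∀ {s t} → ¬ Adj (FSSD m G) (inj₂ s) (inj₂ t)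
  no-adj-subdivisions ((e , k , false) , inj₁ ())
  no-adj-subdivisions ((e , k , true)  , inj₁ ())
  no-adj-subdivisions ((e , k , false) , inj₂ ())
  no-adj-subdivisions ((e , k , true)  , inj₂ ())

  subdivision-ends : ∀ {x e k} → Adj (FSSD m G) (inj₁ x) (inj₂ (e , k)) →
                     x ≡ proj₁ (ends G e) ⊎ x ≡ proj₂ (ends G e)
  subdivision-ends ((e , k , false) , inj₁ refl) = inj₁ refl
  subdivision-ends ((e , k , true)  , inj₁ refl) = inj₂ refl
  subdivision-ends ((e , k , false) , inj₂ ())
  subdivision-ends ((e , k , true)  , inj₂ ())

  common-neighbour : ∀ {x y e k} → Adj (FSSD m G) (inj₁ x) (inj₂ (e , k)) →
                     Adj (FSSD m G) (inj₂ (e , k)) (inj₁ y) → x ≡ y ⊎ Adj G x y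
  common-neighbour {e = e} a b with subdivision-ends a | subdivision-ends (adj-sym b)
  ... | inj₁ refl | inj₁ refl = inj₁ refl
  ... | inj₂ refl | inj₂ refl = inj₁ refl
  ... | inj₁ refl | inj₂ refl = inj₂ (e , inj₁ refl)
  ... | inj₂ refl | inj₁ refl = inj₂ (e , inj₂ refl)

  short-walk : ∀ {x y ℓ} → Walk (FSSD m G) (inj₁ x) (inj₁ y) ℓ → ℓ ≤ 3 → x ≡ y ⊎ Adj G x y
  short-walk here _ = inj₁ refl
  short-walk (step {v = inj₁ _} a _) _ = ⊥-elim (no-adj-originals a)
  short-walk (step {v = inj₂ _} a (step b here)) _ = common-neighbour a b
  short-walk (step {v = inj₂ _} a (step {v = inj₂ _} b _)) _ = ⊥-elim (no-adj-subdivisions b)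
  short-walk (step {v = inj₂ _} a (step {v = inj₁ _} b (step c here))) _ =
    ⊥-elim (no-adj-originals c)
  short-walk (step {v = inj₂ _} a (step {v = inj₁ _} b (step c (step d _)))) (s≤s (s≤s (s≤s ())))

Separated : (G : Graph) {k : ℕ} → (V G → Fin k) → Set
Separated G r = ∀ {u v} → r u ≡ r v → u ≢ v → toℕ (r u) ≤ 1 × ¬ Adj G u v

module SubdivisionColouring (m : ℕ) (G : Graph) {k : ℕ} (r : V G → Fin k)
                            (separated : Separated G r) where
  open Subdivision m G

  colouring : V (FSSD m G) → Fin (suc k)
  colouring (inj₁ x) = suc (r x)
  colouring (inj₂ _) = zero

  no-close-pair : ∀ {u v ℓ} → colouring u ≡ colouring v → u ≢ v →
                  Walk (FSSD m G) u v ℓ → ℓ ≤ suc (toℕ (colouring u)) → ⊥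
  no-close-pair {inj₂ _} {inj₂ _} _ u≢v here _ = u≢v refl
  no-close-pair {inj₂ _} {inj₂ _} _ _ (step a here) _ = no-adj-subdivisions a
  no-close-pair {inj₂ _} {inj₂ _} _ _ (step _ (step _ _)) (s≤s ())
  no-close-pair {inj₁ _} {inj₂ _} ()
  no-close-pair {inj₂ _} {inj₁ _} ()
  no-close-pair {inj₁ x} {inj₁ y} eq u≢v w ℓ≤
    with separated (suc-injective eq) (u≢v ∘ cong inj₁)
  ... | r≤1 , ¬adj with short-walk w (≤-trans ℓ≤ (s≤s (s≤s r≤1)))
  ...   | inj₁ x≡y = u≢v (cong inj₁ x≡y)
  ...   | inj₂ adj = ¬adj adj

  subdivision-colouring : HasPackingColouring (FSSD m G) (suc k)
  subdivision-colouring = colouring , λ j u v cu cv u≢v ℓ ℓ≤ w →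
    no-close-pair (trans cu (sym cv)) u≢v w (subst (λ t → ℓ ≤ suc (toℕ t)) (sym cu) ℓ≤)

module CoronaColouring (n p : ℕ) where

  shade : Bool → Fin (2 + n)
  shade true  = zero
  shade false = suc zero

  shade-injective : ∀ {b b'} → shade b ≡ shade b' → b ≡ b'
  shade-injective {true}  {true}  _ = refl
  shade-injective {false} {false} _ = refl
  shade-injective {true}  {false} ()
  shade-injective {false} {true}  ()

  shade≤1 : ∀ b → toℕ (shade b) ≤ 1
  shade≤1 true  = z≤n
  shade≤1 false = s≤s z≤n

  shade≢top : ∀ b (i : Fin n) → shade b ≢ suc (suc i)
  shade≢top true  i ()
  shade≢top false i ()

  corona-colour : V (K n ⋆ P p) → Fin (2 + n)
  corona-colour (inj₁ i)       = suc (suc i)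
  corona-colour (inj₂ (_ , h)) = shade (parity (toℕ h))

  corona-separated : Separated (K n ⋆ P p) corona-colour
  corona-separated {inj₁ i} {inj₁ j} eq i≢j =
    ⊥-elim (i≢j (cong inj₁ (suc-injective (suc-injective eq))))
  corona-separated {inj₁ i} {inj₂ (_ , h)} eq _ = ⊥-elim (shade≢top _ i (sym eq))
  corona-separated {inj₂ (_ , h)} {inj₁ j} eq _ = ⊥-elim (shade≢top _ j eq)
  corona-separated {inj₂ (_ , h)} {inj₂ _} eq _ =
    shade≤1 (parity (toℕ h)) , λ adj → P-adj-parity (proj₂ (copies-adj⁻¹ adj)) (shade-injective eq)

corona-upper-bound : ∀ n p m → HasPackingColouring (FSSD m (K n ⋆ P p)) (n + 3)
corona-upper-bound n p m =
  subst (HasPackingColouring (FSSD m (K n ⋆ P p))) (+-comm 3 n)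
        (SubdivisionColouring.subdivision-colouring m (K n ⋆ P p)
          (CoronaColouring.corona-colour n p) (CoronaColouring.corona-separated n p))

module Midpoints (m : ℕ) (G : Graph) where

  mid : ∀ {x y} → Adj G x y → V (FSSD (suc m) G)
  mid a = inj₂ (proj₁ a , zero)

  mid-left : ∀ {x y} (a : Adj G x y) → Adj (FSSD (suc m) G) (mid a) (inj₁ x)
  mid-left (e , inj₁ eq) = (e , zero , false) , inj₂ (cong (λ q → inj₁ (proj₁ q) , inj₂ (e , zero)) eq)
  mid-left (e , inj₂ eq) = (e , zero , true)  , inj₂ (cong (λ q → inj₁ (proj₂ q) , inj₂ (e , zero)) eq)

  mid-right : ∀ {x y} (a : Adj G x y) → Adj (FSSD (suc m) G) (mid a) (inj₁ y)
  mid-right (e , inj₁ eq) = (e , zero , true)  , inj₂ (cong (λ q → inj₁ (proj₂ q) , inj₂ (e , zero)) eq)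
  mid-right (e , inj₂ eq) = (e , zero , false) , inj₂ (cong (λ q → inj₁ (proj₁ q) , inj₂ (e , zero)) eq)

  lift : ∀ {x y} → Adj G x y → Walk (FSSD (suc m) G) (inj₁ x) (inj₁ y) 2
  lift a = step (adj-sym (mid-left a)) (step (mid-right a) here)

  mid-cancel : ∀ {u v w} (a : Adj G u w) (b : Adj G v w) → mid a ≡ mid b → u ≡ v
  mid-cancel a b e = same-edge a b (cong proj₁ (inj₂-injective e))

  module MidpointCount {k : ℕ} (c : V (FSSD (suc m) G) → Fin k)
                       (packing : IsPackingColouring (FSSD (suc m) G) k c) where
    open PackingColouring (FSSD (suc m) G) c packing

    zero-vertex-count : ∀ {N w} → colour (inj₁ w) ≡ 0 → (u : Fin (suc N) → V G) →
                        Injective _≡_ _≡_ u → (∀ a → Adj G (u a) w) → 2 + N ≤ k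
    zero-vertex-count z0 u u-inj adj =
      nonzero-count (λ a → c (mid (adj a))) distinct
                    (λ a → around-zero-nonzero z0 (mid-right (adj a)) (λ ()))
      where
      distinct : Injective _≡_ _≡_ (λ a → c (mid (adj a)))
      distinct {a} {b} e with a ≟ᶠ b
      ... | yes a≡b = a≡b
      ... | no a≢b = ⊥-elim (around-zero-distinct z0 (mid-right (adj a)) (mid-right (adj b))
                               (λ ()) (a≢b ∘ u-inj ∘ mid-cancel (adj a) (adj b)) e)

module LowerBound (n' p' m' : ℕ) where
  n p : ℕ
  n = 3 + n'
  p = 2 + p'

  G : Graph
  G = K n ⋆ P p

  F : Graph
  F = FSSD (suc m') G

  open Midpoints m' G

  T : Fin n → V F
  T i = inj₁ (inj₁ i)

  C : Fin n → Fin p → V F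
  C i h = inj₁ (inj₂ (i , h))

  T-cancel : ∀ {i j} → T i ≡ T j → i ≡ j
  T-cancel refl = refl

  top-top : ∀ {i j} → i ≢ j → Adj G (inj₁ i) (inj₁ j)
  top-top i≢j = base-adj (K-adj i≢j)

  copy-top : ∀ {i j} h → i ≢ j → Adj G (inj₂ (i , h)) (inj₁ j)
  copy-top h i≢j = copy-base-adj (K-adj i≢j)

  copy-copy : ∀ i → Adj G (inj₂ (i , zero)) (inj₂ (i , suc zero))
  copy-copy i = copy-adj P-adj₀₁

  module _ {k : ℕ} (c : V F → Fin k) (packing : IsPackingColouring F k c) where
    open PackingColouring F c packing
    open MidpointCount c packing

    -- Case A: a vertex T i of index 0 has n + 2 distinct neighbours in G.
    module ZeroTop (i : Fin n) (zero-top : colour (T i) ≡ 0) where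
      other : Fin (2 + n') → Fin n
      other = punchIn i

      row : Fin (2 + n') → V G
      row l = inj₂ (other l , zero)

      -- Neighbours of T i: one vertex of K_n, two copy vertices at position 1
      -- and the copy vertex at position 0 of every other path.
      neighbour : Fin (2 + n) → V G
      neighbour = inj₁ (other zero) ∷ inj₂ (other zero , suc zero)
                ∷ inj₂ (other (suc zero) , suc zero) ∷ row

      neighbour-adj : ∀ a → Adj G (neighbour a) (inj₁ i)
      neighbour-adj zero                = top-top (punchInᵢ≢i i zero)
      neighbour-adj (suc zero)          = copy-top (suc zero) (punchInᵢ≢i i zero)
      neighbour-adj (suc (suc zero))    = copy-top (suc zero) (punchInᵢ≢i i (suc zero))
      neighbour-adj (suc (suc (suc l))) = copy-top zero (punchInᵢ≢i i l)

      neighbour-injective : Injective _≡_ _≡_ neighbour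
      neighbour-injective =
        ∷-injective (∷-injective (∷-injective row-injective (λ l ()))
                                 (λ { zero e → zero≢one (cong proj₁ (inj₂-injective e))
                                    ; (suc l) () }))
                    (λ { zero () ; (suc zero) () ; (suc (suc l)) () })
        where
        row-injective : Injective _≡_ _≡_ row
        row-injective e = punchIn-injective i _ _ (cong proj₁ (inj₂-injective e))
        zero≢one : other zero ≢ other (suc zero)
        zero≢one e with punchIn-injective i zero (suc zero) e
        ... | ()

      zero-top-bound : 3 + n ≤ k
      zero-top-bound = zero-vertex-count zero-top neighbour neighbour-injective neighbour-adj

    -- Case B: all vertices of K_n have nonzero, hence pairwise different, indices.
    module NonzeroTops (nonzero-top : ∀ j → colour (T j) ≢ 0) where
      -- Vertices of K_n are at distance 2 in the subdivision.
      tops-injective : Injective _≡_ _≡_ (c ∘ T)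
      tops-injective {j} {l} e with j ≟ᶠ l
      ... | yes j≡l = j≡l
      ... | no j≢l = ⊥-elim (differ (j≢l ∘ T-cancel) (lift (top-top j≢l)) (2≤suc (nonzero-top j)) e)

      Fresh : V F → Set
      Fresh u = colour u ≢ 0 × (∀ j → c u ≢ c (T j))

      two-fresh : ∀ {u v} → Fresh u → Fresh v → c u ≢ c v → 3 + n ≤ k
      two-fresh {u} {v} (u≢0 , u-new) (v≢0 , v-new) u≢v =
        nonzero-count (c u ∷ c v ∷ c ∘ T)
          (∷-injective (∷-injective tops-injective v-new) λ { zero → u≢v ; (suc j) → u-new j })
          nonzero
        where
        nonzero : ∀ a → toℕ ((c u ∷ c v ∷ c ∘ T) a) ≢ 0
        nonzero zero          = u≢0
        nonzero (suc zero)    = v≢0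
        nonzero (suc (suc j)) = nonzero-top j

      -- Indices 1 and 2 cannot serve three vertices of K_n.
      big-top : Σ (Fin n) λ i → 3 ≤ colour (T i)
      big-top with 3 ≤? colour (T zero) | 3 ≤? colour (T (suc zero)) | 3 ≤? colour (T (suc (suc zero)))
      ... | yes big | _       | _       = zero , big
      ... | no _    | yes big | _       = suc zero , big
      ... | no _    | no _    | yes big = suc (suc zero) , big
      ... | no s₀   | no s₁   | no s₂   =
        ⊥-elim (no-three-in-one-or-two (small zero s₀) (small (suc zero) s₁) (small (suc (suc zero)) s₂)
                  (distinct (λ ())) (distinct (λ ())) (distinct (λ ())))
        where
        small : ∀ j → ¬ 3 ≤ colour (T j) → OneOrTwo (colour (T j))
        small j = one-or-two (nonzero-top j)
        distinct : ∀ {j l} → j ≢ l → colour (T j) ≢ colour (T l)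
        distinct j≢l = j≢l ∘ tops-injective ∘ toℕ-injective

      module BigTop (i : Fin n) (big : 3 ≤ colour (T i)) where
        a b : Fin n
        a = punchIn i zero
        b = punchIn i (suc zero)

        i≢a : i ≢ a
        i≢a = punchInᵢ≢i i zero ∘ sym

        i≢b : i ≢ b
        i≢b = punchInᵢ≢i i (suc zero) ∘ sym

        a≢b : a ≢ b
        a≢b e with punchIn-injective i zero (suc zero) e
        ... | ()

        -- A copy vertex of T i's path is at distance 2 from the other T j and
        -- at distance 4 from T i, whose index is at least 3.
        copy-fresh : ∀ {h} → colour (C i h) ≢ 0 → Fresh (C i h)
        copy-fresh {h} C≢0 = C≢0 , away
          where
          away : ∀ j → c (C i h) ≢ c (T j)
          away j with i ≟ᶠ j
          ... | yes refl = λ e → differ (λ ()) (lift (top-top i≢a) ++ʷ lift (adj-sym (copy-top h i≢a)))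
                                        (s≤s big) (sym e)
          ... | no i≢j = differ (λ ()) (lift (copy-top h i≢j)) (2≤suc C≢0)

        spoke : Fin p → (l : Fin n) → i ≢ l → V F
        spoke h l i≢l = mid (copy-top h i≢l)

        -- A spoke is adjacent to its own end T l.
        spoke-vs-own-top : ∀ h l i≢l → c (spoke h l i≢l) ≢ c (T l)
        spoke-vs-own-top h l i≢l = differ (λ ()) (step (mid-right (copy-top h i≢l)) here) (s≤s z≤n)

        spoke-to-one-top : ∀ h l i≢l → colour (T l) ≡ 1 → colour (spoke h l i≢l) ≢ 1
        spoke-to-one-top h l i≢l one e = spoke-vs-own-top h l i≢l (toℕ-injective (trans e (sym one)))

        module ZeroCopy (h : Fin p) (zero-copy : colour (C i h) ≡ 0) where
          spoke-nonzero : ∀ l i≢l → colour (spoke h l i≢l) ≢ 0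
          spoke-nonzero l i≢l = around-zero-nonzero zero-copy (mid-left (copy-top h i≢l)) (λ ())

          spoke-distinct : ∀ {l l'} i≢l i≢l' → l ≢ l' → c (spoke h l i≢l) ≢ c (spoke h l' i≢l')
          spoke-distinct i≢l i≢l' l≢l' =
            around-zero-distinct zero-copy (mid-left (copy-top h i≢l)) (mid-left (copy-top h i≢l'))
              (λ ()) (l≢l' ∘ inj₁-injective ∘ mid-cancel (adj-sym (copy-top h i≢l)) (adj-sym (copy-top h i≢l')))

          spoke-fresh : ∀ l i≢l → colour (spoke h l i≢l) ≢ 1 → Fresh (spoke h l i≢l)
          spoke-fresh l i≢l ≢1 = spoke-nonzero l i≢l , away
            where
            away : ∀ j → c (spoke h l i≢l) ≢ c (T j)
            away j with l ≟ᶠ j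
            ... | yes refl = spoke-vs-own-top h l i≢l
            ... | no l≢j = differ (λ ()) (step (mid-right (copy-top h i≢l)) (lift (top-top l≢j)))
                                  (3≤suc (spoke-nonzero l i≢l) ≢1)

          spoke-fresh-anyway : (∀ j → colour (T j) ≢ 1) → ∀ l i≢l → Fresh (spoke h l i≢l)
          spoke-fresh-anyway no-one l i≢l with colour (spoke h l i≢l) ≟ 1
          ... | no ≢1  = spoke-fresh l i≢l ≢1
          ... | yes ≡1 = spoke-nonzero l i≢l , λ j e → no-one j (trans (cong toℕ (sym e)) ≡1)

        module ZeroCopyBound (h h' : Fin p) (h≢h' : h ≢ h')
                             (adj : Adj G (inj₂ (i , h)) (inj₂ (i , h')))
                             (zero-h : colour (C i h) ≡ 0) where
          open ZeroCopy h zero-h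

          -- Some T j has index 1; then T j's spoke is fresh, and a second fresh
          -- vertex is the spoke towards a third index l, or the copy (i, h'),
          -- or, when (i, h') has index 0 too, the spokes of (i, h') do.
          module TopOfIndexOne (j : Fin n) (one-j : colour (T j) ≡ 1) where
            i≢j : i ≢ j
            i≢j e with subst (3 ≤_) one-j (subst (λ t → 3 ≤ colour (T t)) e big)
            ... | s≤s ()

            third : Σ (Fin n) λ l → i ≢ l × j ≢ l
            third with j ≟ᶠ a
            ... | yes refl = b , i≢b , a≢b
            ... | no j≢a   = a , i≢a , j≢a

            l : Fin n
            l = proj₁ third

            i≢l : i ≢ l
            i≢l = proj₁ (proj₂ third)

            l≢j : l ≢ j
            l≢j = proj₂ (proj₂ third) ∘ sym

            spoke-j-not-one : ∀ h'' → colour (spoke h'' j i≢j) ≢ 1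
            spoke-j-not-one h'' = spoke-to-one-top h'' j i≢j one-j

            bound : 3 + n ≤ k
            bound with colour (spoke h l i≢l) ≟ 1 | colour (C i h') ≟ 0
            ... | no ≢1 | _ =
              two-fresh (spoke-fresh l i≢l ≢1) (spoke-fresh j i≢j (spoke-j-not-one h))
                        (spoke-distinct i≢l i≢j l≢j)
            ... | yes _ | no C'≢0 =
              two-fresh (spoke-fresh j i≢j (spoke-j-not-one h)) (copy-fresh C'≢0)
                        (differ (λ ()) (step (mid-left (copy-top h i≢j)) (lift adj))
                                (3≤suc (spoke-nonzero j i≢j) (spoke-j-not-one h)))
            ... | yes one-l | yes zero-h' =
              two-fresh (Z'.spoke-fresh l i≢l l'≢1) (Z'.spoke-fresh j i≢j (spoke-j-not-one h'))
                        (Z'.spoke-distinct i≢l i≢j l≢j)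
              where
              module Z' = ZeroCopy h' zero-h'
              -- The spokes from (i, h) and (i, h') towards T l meet at T l.
              spokes-differ : spoke h' l i≢l ≢ spoke h l i≢l
              spokes-differ = h≢h' ∘ sym ∘ cong proj₂ ∘ inj₂-injective
                              ∘ mid-cancel (copy-top h' i≢l) (copy-top h i≢l)
              l'≢1 : colour (spoke h' l i≢l) ≢ 1
              l'≢1 e = differ spokes-differ
                         (step (mid-right (copy-top h' i≢l)) (step (adj-sym (mid-right (copy-top h i≢l))) here))
                         (2≤suc (Z'.spoke-nonzero l i≢l)) (toℕ-injective (trans e (sym one-l)))

          bound : 3 + n ≤ k
          bound with any? (λ j → colour (T j) ≟ 1)
          ... | no none = two-fresh (spoke-fresh-anyway no-one a i≢a) (spoke-fresh-anyway no-one b i≢b)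
                                    (spoke-distinct i≢a i≢b a≢b)
            where no-one : ∀ j → colour (T j) ≢ 1
                  no-one j e = none (j , e)
          ... | yes (j , one-j) = TopOfIndexOne.bound j one-j

        big-top-bound : 3 + n ≤ k
        big-top-bound with colour (C i zero) ≟ 0 | colour (C i (suc zero)) ≟ 0
        ... | yes z₀ | _      = ZeroCopyBound.bound zero (suc zero) (λ ()) (copy-copy i) z₀
        ... | no _   | yes z₁ = ZeroCopyBound.bound (suc zero) zero (λ ()) (adj-sym (copy-copy i)) z₁
        ... | no n₀  | no n₁  =
          two-fresh (copy-fresh n₀) (copy-fresh n₁) (differ (λ ()) (lift (copy-copy i)) (2≤suc n₀))

      nonzero-tops-bound : 3 + n ≤ k
      nonzero-tops-bound = BigTop.big-top-bound (proj₁ big-top) (proj₂ big-top)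

    colours-needed : 3 + n ≤ k
    colours-needed with any? (λ j → colour (T j) ≟ 0)
    ... | yes (i , zero-top) = ZeroTop.zero-top-bound i zero-top
    ... | no none = NonzeroTops.nonzero-tops-bound (λ j e → none (j , e))

  corona-lower-bound : ∀ k → HasPackingColouring F k → n + 3 ≤ k
  corona-lower-bound k (c , packing) = subst (_≤ k) (+-comm 3 n) (colours-needed c packing)

theorem1 : (n p m : ℕ) → 3 ≤ n → 2 ≤ p → 1 ≤ m →
    PackingChromaticNumber≡ (FSSD m (K n ⋆ P p)) (n + 3)
theorem1 (suc (suc (suc n'))) (suc (suc p')) (suc m') (s≤s (s≤s (s≤s _))) (s≤s (s≤s _)) (s≤s _) =
  corona-upper-bound (3 + n') (2 + p') (suc m') , LowerBound.corona-lower-bound n' p' m'
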